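{- For every hybrid logic formula $\phi$, the sequent $\vdash\phi$ is provable in $\mathbf{DS}$ if and only if the disjunctive state $\mathbf{P}:\phi$ is winning.
   Context: Language: disjoint countably infinite sets $N$ (nominals) and $P$ (propositional variables); formulas $\phi ::= p \mid i \mid R(i,j) \mid \phi\wedge\phi \mid \phi\vee\phi \mid \phi\rightarrow\phi \mid \neg\phi \mid @_i\phi \mid \Box\phi \mid \Diamond\phi$; $p$, $i$, $R(i,j)$ are elementary. A model $\mathcal{M}=(\mathsf{W},\mathsf{R},\mathsf{V},\mathsf{g})$ ($\mathsf{W}\ne\emptyset$, $\mathsf{R}\subseteq\mathsf{W}^2$, $\mathsf{V}:P\to\mathcal{P}(\mathsf{W})$, $\mathsf{g}:N\to\mathsf{W}$) is named if $\mathsf{g}$ is surjective; truth is standard hybrid-logic semantics. Semantic game over a named model $\mathcal{M}$ (players Me (I) and You). Game states: $\mathbf{Q},i:\phi$ (claim at world $\mathsf{g}(i)$) or $\mathbf{Q}:\phi$, $\mathbf{Q}\in\{\mathbf{P},\mathbf{O}\}$. The tree $\mathbf{G}(\mathcal{M},g)$ (nodes labelled I or Y) is given by these rules for $\mathbf{P}$-states; for $\mathbf{O}$-states swap I/Y and $\mathbf{P}$/$\mathbf{O}$. $\mathbf{P},i:\psi_1\vee\psi_2$: labelled I, children $\mathbf{G}(\mathbf{P},i:\psi_1)$, $\mathbf{G}(\mathbf{P},i:\psi_2)$. $\mathbf{P},i:\psi_1\wedge\psi_2$: labelled Y, same children. $\mathbf{P},i:\psi_1\rightarrow\psi_2$: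 labelled I, children $\mathbf{G}(\mathbf{O},i:\psi_1)$, $\mathbf{G}(\mathbf{P},i:\psi_2)$. $\mathbf{P},i:\neg\psi$: labelled I, child $\mathbf{G}(\mathbf{O},i:\psi)$. $\mathbf{P},i:@_j\psi$: labelled I, child $\mathbf{G}(\mathbf{P},j:\psi)$. $\mathbf{P},i:\Box\psi$: labelled Y, children $\mathbf{G}(\mathbf{P},j:\neg R(i,j)\vee\psi)$, $j\in N$. $\mathbf{P},i:\Diamond\psi$: labelled I, children $\mathbf{G}(\mathbf{P},j:R(i,j)\wedge\psi)$, $j\in N$. $\mathbf{P}:\psi$: labelled Y, children $\mathbf{G}(\mathbf{P},i:\psi)$, $i\in N$. Leaves: $\mathbf{P},i:\phi$ with $\phi$ elementary is labelled I iff $\mathcal{M},\mathsf{g}(i)\models\phi$; $\mathbf{O},i:\phi$ labelled I iff $\mathcal{M},\mathsf{g}(i)\not\models\phi$. A strategy for Me keeps exactly one child at each non-leaf I-node; it is winning if all leaves are labelled I. A game state $\mathbf{Q},i:\phi$ with $\phi$ elementary is elementary. Disjunctive game. A disjunctive state is a finite nonempty multiset of game states $g_1\bigvee\dots\bigvee g_n$; elementary if all its states are; game valid if for every named model $\mathcal{M}$ some $g_k$ admits a winning strategy for Me in $\mathbf{G}(\mathcal{M},g_k)$. A regulation $\rho$ maps each non-elementary disjunctive state to one of its non-elementary game states. The tree $\mathbf{DG}(D,\rho)$: if $\rho(D'\bigvee g)=g$ and $g$ is labelled Y, $D'\bigvee g$ is labelled Y with children $\mathbf{DG}(D'\bigvee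 g',\rho)$ for all children $g'$ of $g$; if $g$ is labelled I, $D'\bigvee g$ is labelled I with those children plus $\mathbf{DG}(D'\bigvee g\bigvee g,\rho)$; an elementary disjunctive state is a leaf labelled I iff game valid. A strategy for Me keeps one child at each non-leaf I-node; winning if every branch is finite and ends in a leaf labelled I. $D$ is winning if for some $\rho$ I have a winning strategy for $\mathbf{DG}(D,\rho)$. Calculus $\mathbf{DS}$. A labelled formula is $i:\phi$ with $i\in N$. A sequent $\Gamma\vdash\Delta$ has $\Gamma,\Delta$ finite multisets of formulas and labelled formulas; it corresponds to the disjunctive state containing $\mathbf{O},i:\phi$ (resp. $\mathbf{O}:\phi$) for each $i:\phi$ (resp. $\phi$) in $\Gamma$ and $\mathbf{P},i:\phi$ (resp. $\mathbf{P}:\phi$) for each element of $\Delta$. A sequent is elementary/valid iff its disjunctive state is elementary/game valid. Rules (premises above, conclusion below): (V) axiom: $\Gamma\vdash\Delta$ for elementary valid $\Gamma\vdash\Delta$. (CL) from $\Gamma,i:\phi,i:\phi\vdash\Delta$ infer $\Gamma,i:\phi\vdash\Delta$; (CR) from $\Gamma\vdash i:\phi,i:\phi,\Delta$ infer $\Gamma\vdash i:\phi,\Delta$. (U) from $\vdash i:\phi$ infer $\vdash\phi$. ($L_\vee$) from $\Gamma,i:\phi\vdash\Delta$ and $\Gamma,i:\psi\vdash\Delta$ infer $\Gamma,i:\phi\vee\psi\vdash\Delta$. ($R^1_\vee$)/($R^2_\vee$) from $\Gamma\vdash i:\phi,\Delta$ (resp. $\Gamma\vdash i:\psi,\Delta$)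 infer $\Gamma\vdash i:\phi\vee\psi,\Delta$. ($L^1_\wedge$)/($L^2_\wedge$) from $\Gamma,i:\phi\vdash\Delta$ (resp. $\Gamma,i:\psi\vdash\Delta$) infer $\Gamma,i:\phi\wedge\psi\vdash\Delta$. ($R_\wedge$) from $\Gamma\vdash i:\phi,\Delta$ and $\Gamma\vdash i:\psi,\Delta$ infer $\Gamma\vdash i:\phi\wedge\psi,\Delta$. ($R^1_\rightarrow$) from $\Gamma,i:\phi\vdash\Delta$ infer $\Gamma\vdash i:\phi\rightarrow\psi,\Delta$; ($R^2_\rightarrow$) from $\Gamma\vdash i:\psi,\Delta$ infer $\Gamma\vdash i:\phi\rightarrow\psi,\Delta$. ($L_\rightarrow$) from $\Gamma\vdash i:\phi,\Delta$ and $\Gamma,i:\psi\vdash\Delta$ infer $\Gamma,i:\phi\rightarrow\psi\vdash\Delta$. ($L_\neg$) from $\Gamma\vdash i:\phi,\Delta$ infer $\Gamma,i:\neg\phi\vdash\Delta$; ($R_\neg$) from $\Gamma,i:\phi\vdash\Delta$ infer $\Gamma\vdash i:\neg\phi,\Delta$. ($L_\Box$) from $\Gamma,j:\neg R(i,j)\vee\phi\vdash\Delta$ infer $\Gamma,i:\Box\phi\vdash\Delta$; ($R_\Box$) from $\Gamma\vdash j:\neg R(i,j)\vee\phi,\Delta$ infer $\Gamma\vdash i:\Box\phi,\Delta$. ($L_\Diamond$) from $\Gamma,j:R(i,j)\wedge\phi\vdash\Delta$ infer $\Gamma,i:\Diamond\phi\vdash\Delta$; ($R_\Diamond$) from $\Gamma\vdash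 j:R(i,j)\wedge\phi,\Delta$ infer $\Gamma\vdash i:\Diamond\phi,\Delta$. ($L_@$) from $\Gamma,j:\phi\vdash\Delta$ infer $\Gamma,i:@_j\phi\vdash\Delta$; ($R_@$) from $\Gamma\vdash j:\phi,\Delta$ infer $\Gamma\vdash i:@_j\phi,\Delta$. In ($R_\Box$), ($L_\Diamond$) and (U) the nominal $j$ (resp. $i$) must not occur in the conclusion. A proof is a finite tree of rule applications whose leaves are instances of (V). -}

module Defs where

open import Level using (Level) renaming (suc to lsuc; zero to lzero)
open import Data.Nat using (ℕ)
open import Data.Bool using (Bool; true; false)
open import Data.Unit using (⊤; tt)
open import Data.Empty using (⊥)
open import Data.Product using (Σ; ∃; _×_; _,_; proj₁; proj₂)
open import Data.List using (List; []; _∷_; _++_; map; [_])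
open import Data.List.Relation.Unary.Any using (Any; _─_)
open import Data.List.Relation.Unary.All using (All)
open import Data.List.Membership.Propositional using (_∈_)
open import Data.List.Relation.Binary.Permutation.Propositional using (_↭_)
open import Relation.Binary.PropositionalEquality using (_≡_; _≢_)
open import Relation.Nullary using (¬_)

-- Syntax.  Nominals N and propositional variables P are two disjoint
-- countably infinite sets; both are represented by ℕ (as separate
-- syntactic categories, so they are disjoint).

Nom : Set
Nom = ℕ

PVar : Set
PVar = ℕ

infixr 6 _∧_
infixr 5 _∨_
infixr 4 _⇒_

data Fm : Set where
  var : PVar → Fm
  nom : Nom → Fm
  rel : Nom → Nom → Fm
  _∧_ : Fm → Fm → Fm
  _∨_ : Fm → Fm → Fm
  _⇒_ : Fm → Fm → Fm
  ~_  : Fm → Fm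
  at  : Nom → Fm → Fm
  □_  : Fm → Fm
  ◇_  : Fm → Fm

isElemFm : Fm → Bool
isElemFm (var _)   = true
isElemFm (nom _)   = true
isElemFm (rel _ _) = true
isElemFm _         = false

record Model : Set₁ where
  field
    W     : Set
    R     : W → W → Set
    V     : PVar → W → Set
    g     : Nom → W
    named : ∀ (w : W) → ∃ λ (i : Nom) → g i ≡ w

-- truth of an elementary formula at world g(i)
-- (for non-elementary formulas this is never used)
holdsElem : Model → Nom → Fm → Set
holdsElem M i (var p)   = Model.V M p (Model.g M i)
holdsElem M i (nom j)   = Model.g M i ≡ Model.g M j
holdsElem M i (rel j k) = Model.R M (Model.g M j) (Model.g M k)
holdsElem M i _         = ⊥

data Pol : Set where
  P O : Pol

flipPol : Pol → Pol
flipPol P = O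
flipPol O = P

data Player : Set where
  Me You : Player

-- game states  Q,i:φ  and  Q:φ
data GS : Set where
  lab : Pol → Nom → Fm → GS
  unl : Pol → Fm → GS

isElemGS : GS → Bool
isElemGS (lab _ _ φ) = isElemFm φ
isElemGS (unl _ _)   = false

forPol : Pol → Player → Player
forPol P x   = x
forPol O Me  = You
forPol O You = Me

owner : GS → Player
owner (lab q i (a ∧ b)) = forPol q You
owner (lab q i (a ∨ b)) = forPol q Me
owner (lab q i (a ⇒ b)) = forPol q Me
owner (lab q i (~ a))   = forPol q Me
owner (lab q i (at j a)) = forPol q Me
owner (lab q i (□ a))   = forPol q You
owner (lab q i (◇ a))   = forPol q Me
owner (lab q i _)       = Me      -- elementary: irrelevant (leaf)
owner (unl q a)         = forPol q You

Idx : GS → Set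
Idx (lab q i (a ∧ b))  = Bool
Idx (lab q i (a ∨ b))  = Bool
Idx (lab q i (a ⇒ b))  = Bool
Idx (lab q i (~ a))    = ⊤
Idx (lab q i (at j a)) = ⊤
Idx (lab q i (□ a))    = Nom
Idx (lab q i (◇ a))    = Nom
Idx (lab q i _)        = ⊥
Idx (unl q a)          = Nom

child : (g : GS) → Idx g → GS
child (lab q i (a ∧ b)) true  = lab q i a
child (lab q i (a ∧ b)) false = lab q i b
child (lab q i (a ∨ b)) true  = lab q i a
child (lab q i (a ∨ b)) false = lab q i b
child (lab q i (a ⇒ b)) true  = lab (flipPol q) i a
child (lab q i (a ⇒ b)) false = lab q i b
child (lab q i (~ a)) _       = lab (flipPol q) i a
child (lab q i (at j a)) _    = lab q j a
child (lab q i (□ a)) j       = lab q j (~ rel i j ∨ a)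
child (lab q i (◇ a)) j       = lab q j (rel i j ∧ a)
child (unl q a) i             = lab q i a

leafI : Model → GS → Set
leafI M (lab P i φ) = holdsElem M i φ
leafI M (lab O i φ) = ¬ holdsElem M i φ
leafI M (unl _ _)   = ⊥

-- Winning strategy for Me in G(M,g): keeps one child at each I-node,
-- all children at Y-nodes, all leaves labelled I.  (The game tree has
-- finite depth, so an inductive strategy is exactly a strategy.)
data Win (M : Model) : GS → Set where
  leafW : ∀ {g} → isElemGS g ≡ true → leafI M g → Win M g
  meW   : ∀ {g} → isElemGS g ≡ false → owner g ≡ Me →
          (k : Idx g) → Win M (child g k) → Win M g
  youW  : ∀ {g} → isElemGS g ≡ false → owner g ≡ You →
          ((k : Idx g) → Win M (child g k)) → Win M g

-- Disjunctive game.  Disjunctive states are lists of game states,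
-- considered up to permutation (multisets).

DState : Set
DState = List GS

ElemD : DState → Set
ElemD D = All (λ g → isElemGS g ≡ true) D

NonElemD : DState → Set
NonElemD D = Any (λ g → isElemGS g ≡ false) D

GameValid : DState → Set₁
GameValid D = ∀ (M : Model) → Any (Win M) D

-- a regulation: picks a non-elementary game state of every
-- non-elementary disjunctive state; as a function on multisets it is
-- invariant under permutation.
record Regulation : Set where
  field
    pick     : DState → GS
    pick-∈   : ∀ D → NonElemD D → pick D ∈ D
    pick-ne  : ∀ D → NonElemD D → isElemGS (pick D) ≡ false
    pick-↭   : ∀ {D D'} → D ↭ D' → pick D ≡ pick D'

-- winning strategy for Me in DG(D, ρ) (inductive: every branch finite)
data DWin (ρ : Regulation) : DState → Set₁ where
  dleaf : ∀ {D} → ElemD D → GameValid D → DWin ρ D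
  dyou  : ∀ {D} (ne : NonElemD D) →
          owner (Regulation.pick ρ D) ≡ You →
          ((k : Idx (Regulation.pick ρ D)) →
             DWin ρ (child (Regulation.pick ρ D) k ∷ (D ─ Regulation.pick-∈ ρ D ne))) →
          DWin ρ D
  dme   : ∀ {D} (ne : NonElemD D) →
          owner (Regulation.pick ρ D) ≡ Me →
          (k : Idx (Regulation.pick ρ D)) →
          DWin ρ (child (Regulation.pick ρ D) k ∷ (D ─ Regulation.pick-∈ ρ D ne)) →
          DWin ρ D
  -- the extra child D' ∨ g ∨ g of an I-node
  ddup  : ∀ {D} (ne : NonElemD D) →
          owner (Regulation.pick ρ D) ≡ Me →
          DWin ρ (Regulation.pick ρ D ∷ D) →
          DWin ρ D

Winning : DState → Set₁
Winning D = Σ Regulation λ ρ → DWin ρ D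

data Item : Set where
  lb : Nom → Fm → Item
  pl : Fm → Item

toGS : Pol → Item → GS
toGS q (lb i φ) = lab q i φ
toGS q (pl φ)   = unl q φ

seqState : List Item → List Item → DState
seqState Γ Δ = map (toGS O) Γ ++ map (toGS P) Δ

freshFm : Nom → Fm → Set
freshFm j (var _)   = ⊤
freshFm j (nom i)   = j ≢ i
freshFm j (rel i k) = (j ≢ i) × (j ≢ k)
freshFm j (a ∧ b)   = freshFm j a × freshFm j b
freshFm j (a ∨ b)   = freshFm j a × freshFm j b
freshFm j (a ⇒ b)   = freshFm j a × freshFm j b
freshFm j (~ a)     = freshFm j a
freshFm j (at i a)  = (j ≢ i) × freshFm j a
freshFm j (□ a)     = freshFm j a
freshFm j (◇ a)     = freshFm j a

freshItem : Nom → Item → Set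
freshItem j (lb i φ) = (j ≢ i) × freshFm j φ
freshItem j (pl φ)   = freshFm j φ

freshSeq : Nom → List Item → List Item → Set
freshSeq j Γ Δ = All (freshItem j) Γ × All (freshItem j) Δ

infix 2 _⊢_

-- Sequents are pairs of multisets, realised as lists with explicit
-- exchange (permutation) steps.
data _⊢_ : List Item → List Item → Set₁ where
  V    : ∀ {Γ Δ} → ElemD (seqState Γ Δ) → GameValid (seqState Γ Δ) → Γ ⊢ Δ
  exL  : ∀ {Γ Γ' Δ} → Γ ↭ Γ' → Γ ⊢ Δ → Γ' ⊢ Δ
  exR  : ∀ {Γ Δ Δ'} → Δ ↭ Δ' → Γ ⊢ Δ → Γ ⊢ Δ'
  CL   : ∀ {Γ Δ i φ} → lb i φ ∷ lb i φ ∷ Γ ⊢ Δ → lb i φ ∷ Γ ⊢ Δ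
  CR   : ∀ {Γ Δ i φ} → Γ ⊢ lb i φ ∷ lb i φ ∷ Δ → Γ ⊢ lb i φ ∷ Δ
  U    : ∀ {i φ} → freshFm i φ → [] ⊢ [ lb i φ ] → [] ⊢ [ pl φ ]
  L∨   : ∀ {Γ Δ i a b} → lb i a ∷ Γ ⊢ Δ → lb i b ∷ Γ ⊢ Δ → lb i (a ∨ b) ∷ Γ ⊢ Δ
  R∨₁  : ∀ {Γ Δ i a b} → Γ ⊢ lb i a ∷ Δ → Γ ⊢ lb i (a ∨ b) ∷ Δ
  R∨₂  : ∀ {Γ Δ i a b} → Γ ⊢ lb i b ∷ Δ → Γ ⊢ lb i (a ∨ b) ∷ Δ
  L∧₁  : ∀ {Γ Δ i a b} → lb i a ∷ Γ ⊢ Δ → lb i (a ∧ b) ∷ Γ ⊢ Δ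
  L∧₂  : ∀ {Γ Δ i a b} → lb i b ∷ Γ ⊢ Δ → lb i (a ∧ b) ∷ Γ ⊢ Δ
  R∧   : ∀ {Γ Δ i a b} → Γ ⊢ lb i a ∷ Δ → Γ ⊢ lb i b ∷ Δ → Γ ⊢ lb i (a ∧ b) ∷ Δ
  R⇒₁  : ∀ {Γ Δ i a b} → lb i a ∷ Γ ⊢ Δ → Γ ⊢ lb i (a ⇒ b) ∷ Δ
  R⇒₂  : ∀ {Γ Δ i a b} → Γ ⊢ lb i b ∷ Δ → Γ ⊢ lb i (a ⇒ b) ∷ Δ
  L⇒   : ∀ {Γ Δ i a b} → Γ ⊢ lb i a ∷ Δ → lb i b ∷ Γ ⊢ Δ → lb i (a ⇒ b) ∷ Γ ⊢ Δ
  L¬   : ∀ {Γ Δ i a} → Γ ⊢ lb i a ∷ Δ → lb i (~ a) ∷ Γ ⊢ Δ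
  R¬   : ∀ {Γ Δ i a} → lb i a ∷ Γ ⊢ Δ → Γ ⊢ lb i (~ a) ∷ Δ
  L□   : ∀ {Γ Δ i j a} → lb j (~ rel i j ∨ a) ∷ Γ ⊢ Δ → lb i (□ a) ∷ Γ ⊢ Δ
  R□   : ∀ {Γ Δ i j a} → freshSeq j Γ (lb i (□ a) ∷ Δ) →
         Γ ⊢ lb j (~ rel i j ∨ a) ∷ Δ → Γ ⊢ lb i (□ a) ∷ Δ
  L◇   : ∀ {Γ Δ i j a} → freshSeq j (lb i (◇ a) ∷ Γ) Δ →
         lb j (rel i j ∧ a) ∷ Γ ⊢ Δ → lb i (◇ a) ∷ Γ ⊢ Δ
  R◇   : ∀ {Γ Δ i j a} → Γ ⊢ lb j (rel i j ∧ a) ∷ Δ → Γ ⊢ lb i (◇ a) ∷ Δ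
  L-at   : ∀ {Γ Δ i j a} → lb j a ∷ Γ ⊢ Δ → lb i (at j a) ∷ Γ ⊢ Δ
  R-at   : ∀ {Γ Δ i j a} → Γ ⊢ lb j a ∷ Δ → Γ ⊢ lb i (at j a) ∷ Δ

{-# OPTIONS --safe #-}

-- Both directions go through game proofs: derivations on disjunctive states in which every step
-- is a move on a member state that keeps the moved state, so that contraction is implicit.
-- (⇒) Each DS rule is such a move.  The eigenvariable rules (U), (R□), (L◇) become You-moves by
-- renaming the fresh nominal along a surjection σ, which preserves the validity of axioms because
-- a named model precomposed with σ is again named.  A game proof is then played under one fixed
-- regulation, `fair`, which selects You-states first and otherwise a least duplicated I-state:
-- You-moves are answered by inverting the proof, and a move of the proof on h is realised by
-- duplicating the selected states until h is selected twice.
-- (⇐) Every node of a winning strategy is an instance of a DS rule, duplication being contraction,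
-- and the root You-move on P:φ is (U) with a nominal above those of φ.
module Submission where

open import Defs
open import Data.Nat using (ℕ; zero; suc; _+_; _∸_; _⊔_; _≤_; _<_; s≤s; z≤n; _≤?_; _<?_)
import Data.Nat.Properties as ℕ
open import Data.Nat.ListAction using (sum)
open import Data.Nat.ListAction.Properties using (sum-↭)
open import Data.Bool using (true; false)
import Data.Bool as Bool
open import Data.Unit using (⊤; tt)
open import Data.Empty using (⊥; ⊥-elim)
open import Data.Maybe using (Maybe; just; nothing; _>>=_)
open import Data.Maybe.Properties using (just-injective)
open import Data.Product.Properties using (,-injectiveˡ)
open import Data.Product using (Σ; ∃; _×_; _,_; proj₁; proj₂)
open import Data.Sum using (_⊎_; inj₁; inj₂)
open import Data.List using (List; []; _∷_; _++_; [_]; map; filter; length; mapMaybe)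
open import Data.List.Properties using (++-assoc; ≡-dec; ∷-injective; filter-accept; filter-reject)
open import Data.List.Relation.Unary.All using (All; []; _∷_)
import Data.List.Relation.Unary.All as All
open import Data.List.Relation.Unary.All.Properties using (─⁺)
open import Data.List.Relation.Unary.Any using (Any; here; there; _─_)
import Data.List.Relation.Unary.Any as Any
open import Data.List.Membership.Propositional using (_∈_; find; lose)
open import Data.List.Membership.Propositional.Properties using (∈-filter⁺; ∈-filter⁻; ∈-map⁻; ∈-++⁻)
open import Data.List.Relation.Binary.Subset.Propositional using (_⊆_)
open import Data.List.Relation.Binary.Subset.Propositional.Properties
  using (Any-resp-⊆; ⊆-refl; ⊆-reflexive-↭; ∷⁺ʳ; xs⊆x∷xs)
open import Data.List.Relation.Binary.Permutation.Propositional
  using (_↭_; ↭-refl; ↭-sym; ↭-trans; prep; swap)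
open import Data.List.Relation.Binary.Permutation.Propositional.Properties
  using (↭-length; filter-↭; mapMaybe-↭; ∈-resp-↭; All-resp-↭; Any-resp-↭; shift; ++⁺ˡ; ++⁺ʳ; map⁺)
open import Data.List.Relation.Binary.Lex.Strict using (≤-decTotalOrder; this; next)
open import Data.List.Relation.Binary.Pointwise using (Pointwise-≡⇒≡)
import Data.List.Extrema
open import Function using (_∘_; id)
open import Function.Bundles using (_⇔_; mk⇔)
open import Function.Definitions using (StrictlySurjective)
open import Relation.Binary.Bundles using (DecTotalOrder)
open import Relation.Binary.Definitions using (DecidableEquality)
open import Relation.Binary.PropositionalEquality hiding ([_])
open import Relation.Nullary using (¬_; Dec; yes; no)
open import Relation.Nullary.Decidable using (map′)

-- Codes give game states decidable equality and a total order, which `fair` uses to break ties.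
encode : Fm → List ℕ
encode (var p)   = 0 ∷ p ∷ []
encode (nom i)   = 1 ∷ i ∷ []
encode (rel i j) = 2 ∷ i ∷ j ∷ []
encode (a ∧ b)   = 3 ∷ encode a ++ encode b
encode (a ∨ b)   = 4 ∷ encode a ++ encode b
encode (a ⇒ b)   = 5 ∷ encode a ++ encode b
encode (~ a)     = 6 ∷ encode a
encode (at i a)  = 7 ∷ i ∷ encode a
encode (□ a)     = 8 ∷ encode a
encode (◇ a)     = 9 ∷ encode a

depth : Fm → ℕ
depth (a ∧ b)  = suc (depth a ⊔ depth b)
depth (a ∨ b)  = suc (depth a ⊔ depth b)
depth (a ⇒ b)  = suc (depth a ⊔ depth b)
depth (~ a)    = suc (depth a)
depth (at i a) = suc (depth a)
depth (□ a)    = suc (depth a)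
depth (◇ a)    = suc (depth a)
depth _        = 1

decode : ℕ → List ℕ → Maybe (Fm × List ℕ)
decode zero    _               = nothing
decode (suc n) (0 ∷ p ∷ r)     = just (var p , r)
decode (suc n) (1 ∷ i ∷ r)     = just (nom i , r)
decode (suc n) (2 ∷ i ∷ j ∷ r) = just (rel i j , r)
decode (suc n) (3 ∷ r)     = decode n r >>= λ { (a , r) → decode n r >>= λ { (b , r) → just (a ∧ b , r) } }
decode (suc n) (4 ∷ r)     = decode n r >>= λ { (a , r) → decode n r >>= λ { (b , r) → just (a ∨ b , r) } }
decode (suc n) (5 ∷ r)     = decode n r >>= λ { (a , r) → decode n r >>= λ { (b , r) → just ((a ⇒ b) , r) } }
decode (suc n) (6 ∷ r)     = decode n r >>= λ { (a , r) → just (~ a , r) }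
decode (suc n) (7 ∷ i ∷ r) = decode n r >>= λ { (a , r) → just (at i a , r) }
decode (suc n) (8 ∷ r)     = decode n r >>= λ { (a , r) → just (□ a , r) }
decode (suc n) (9 ∷ r)     = decode n r >>= λ { (a , r) → just (◇ a , r) }
decode (suc n) _           = nothing

decode-encode : ∀ a {n} xs → depth a ≤ n → decode n (encode a ++ xs) ≡ just (a , xs)
decode-encode (var p)   xs (s≤s _) = refl
decode-encode (nom i)   xs (s≤s _) = refl
decode-encode (rel i j) xs (s≤s _) = refl
decode-encode (a ∧ b) xs (s≤s d)
  rewrite ++-assoc (encode a) (encode b) xs
        | decode-encode a (encode b ++ xs) (ℕ.m⊔n≤o⇒m≤o _ _ d)
        | decode-encode b xs (ℕ.m⊔n≤o⇒n≤o _ _ d) = refl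
decode-encode (a ∨ b) xs (s≤s d)
  rewrite ++-assoc (encode a) (encode b) xs
        | decode-encode a (encode b ++ xs) (ℕ.m⊔n≤o⇒m≤o _ _ d)
        | decode-encode b xs (ℕ.m⊔n≤o⇒n≤o _ _ d) = refl
decode-encode (a ⇒ b) xs (s≤s d)
  rewrite ++-assoc (encode a) (encode b) xs
        | decode-encode a (encode b ++ xs) (ℕ.m⊔n≤o⇒m≤o _ _ d)
        | decode-encode b xs (ℕ.m⊔n≤o⇒n≤o _ _ d) = refl
decode-encode (~ a)    xs (s≤s d) rewrite decode-encode a xs d = refl
decode-encode (at i a) xs (s≤s d) rewrite decode-encode a xs d = refl
decode-encode (□ a)    xs (s≤s d) rewrite decode-encode a xs d = refl
decode-encode (◇ a)    xs (s≤s d) rewrite decode-encode a xs d = refl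

encode-injective : ∀ {a b} → encode a ≡ encode b → a ≡ b
encode-injective {a} {b} e = ,-injectiveˡ (just-injective (begin
  just (a , [])              ≡⟨ decode-encode a [] (ℕ.m≤m⊔n _ _) ⟨
  decode n (encode a ++ [])  ≡⟨ cong (λ l → decode n (l ++ [])) e ⟩
  decode n (encode b ++ [])  ≡⟨ decode-encode b [] (ℕ.m≤n⊔m (depth a) _) ⟩
  just (b , [])              ∎))
  where
  open ≡-Reasoning
  n : ℕ
  n = depth a ⊔ depth b

asFormula : GS → Fm
asFormula (lab P i φ) = at i φ
asFormula (lab O i φ) = ~ at i φ
asFormula (unl P φ)   = ◇ φ
asFormula (unl O φ)   = □ φ

asState : Fm → GS
asState (at i φ)     = lab P i φ
asState (~ (at i φ)) = lab O i φ
asState (◇ φ)        = unl P φ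
asState (□ φ)        = unl O φ
asState φ            = unl O φ

asState-asFormula : ∀ x → asState (asFormula x) ≡ x
asState-asFormula (lab P i φ) = refl
asState-asFormula (lab O i φ) = refl
asState-asFormula (unl P φ)   = refl
asState-asFormula (unl O φ)   = refl

encodeGS : GS → List ℕ
encodeGS x = encode (asFormula x)

encodeGS-injective : ∀ {x y} → encodeGS x ≡ encodeGS y → x ≡ y
encodeGS-injective {x} {y} e = begin
  x                        ≡⟨ asState-asFormula x ⟨
  asState (asFormula x)    ≡⟨ cong asState (encode-injective e) ⟩
  asState (asFormula y)    ≡⟨ asState-asFormula y ⟩
  y                        ∎
  where open ≡-Reasoning

infix 4 _≟GS_
_≟GS_ : DecidableEquality GS
x ≟GS y = map′ encodeGS-injective (cong encodeGS) (≡-dec ℕ._≟_ (encodeGS x) (encodeGS y))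

mult : GS → DState → ℕ
mult x D = length (filter (x ≟GS_) D)

mult-here : ∀ x D → mult x (x ∷ D) ≡ suc (mult x D)
mult-here x D = cong length (filter-accept (x ≟GS_) refl)

mult-there : ∀ {x y} D → x ≢ y → mult x (y ∷ D) ≡ mult x D
mult-there D x≢y = cong length (filter-reject (_ ≟GS_) x≢y)

mult-∷ : ∀ x y D → mult x D ≤ mult x (y ∷ D)
mult-∷ x y D with x ≟GS y
... | yes refl = subst (mult x D ≤_) (sym (mult-here x D)) (ℕ.n≤1+n _)
... | no x≢y   = ℕ.≤-reflexive (sym (mult-there D x≢y))

mult-↭ : ∀ x {D D'} → D ↭ D' → mult x D ≡ mult x D'
mult-↭ x p = ↭-length (filter-↭ (x ≟GS_) p)

∈⇒mult-pos : ∀ {x D} → x ∈ D → 0 < mult x D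
∈⇒mult-pos {x} {_ ∷ D} (here refl) = subst (0 <_) (sym (mult-here x D)) (s≤s z≤n)
∈⇒mult-pos {x} {y ∷ D} (there p) = ℕ.<-≤-trans (∈⇒mult-pos p) (mult-∷ x y D)

mult-pos⇒∈ : ∀ {x} D → 0 < mult x D → x ∈ D
mult-pos⇒∈ {x} (y ∷ D) pos with x ≟GS y
... | yes x≡y = here x≡y
... | no x≢y  = there (mult-pos⇒∈ D (subst (0 <_) (mult-there D x≢y) pos))

─-↭ : ∀ {x : GS} {D} (p : x ∈ D) → D ↭ x ∷ (D ─ p)
─-↭ (here refl)          = ↭-refl
─-↭ {D = y ∷ D} (there p) = ↭-trans (prep y (─-↭ p)) (swap y _ ↭-refl)

∈-─⁺ : ∀ {g x : GS} {E} (p : g ∈ E) → x ∈ E → x ≢ g → x ∈ (E ─ p)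
∈-─⁺ (here refl) (here refl) x≢g = ⊥-elim (x≢g refl)
∈-─⁺ (here refl) (there q)   _   = q
∈-─⁺ (there p)   (here e)    _   = here e
∈-─⁺ (there p)   (there q)   x≢g = there (∈-─⁺ p q x≢g)

mult≥2⇒∈-─ : ∀ {g : GS} {E} (p : g ∈ E) → 2 ≤ mult g E → g ∈ (E ─ p)
mult≥2⇒∈-─ {g} {_ ∷ E} (here refl) m≥2 rewrite mult-here g E = mult-pos⇒∈ E (ℕ.≤-pred m≥2)
mult≥2⇒∈-─ {g} {y ∷ E} (there p)   m≥2 with g ≟GS y
... | yes g≡y = here g≡y
... | no g≢y  = there (mult≥2⇒∈-─ p (subst (2 ≤_) (mult-there E g≢y) m≥2))

⊆-─ : ∀ {g D E} (p : g ∈ E) → D ⊆ E → 2 ≤ mult g E → D ⊆ (E ─ p)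
⊆-─ {g} p D⊆E m≥2 {x} x∈ with x ≟GS g
... | yes refl = mult≥2⇒∈-─ p m≥2
... | no x≢g   = ∈-─⁺ p (D⊆E x∈) x≢g

ElementarilyValid : DState → Set₁
ElementarilyValid D = ∀ M → Any (λ x → isElemGS x ≡ true × Win M x) D

-- The moved state g stays in the premise child g k ∷ D; the index bounds the height.
data GameProof : ℕ → DState → Set₁ where
  axiom : ∀ {n D} → ElementarilyValid D → GameProof n D
  you   : ∀ {n D g} → g ∈ D → isElemGS g ≡ false → owner g ≡ You →
          ((k : Idx g) → GameProof n (child g k ∷ D)) → GameProof (suc n) D
  me    : ∀ {n D g} → g ∈ D → isElemGS g ≡ false → owner g ≡ Me →
          (k : Idx g) → GameProof n (child g k ∷ D) → GameProof (suc n) D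

weaken : ∀ {n D E} → GameProof n D → D ⊆ E → GameProof n E
weaken (axiom v)             D⊆E = axiom λ M → Any-resp-⊆ D⊆E (v M)
weaken (you g∈ ne own f)     D⊆E = you (D⊆E g∈) ne own λ k → weaken (f k) (∷⁺ʳ _ D⊆E)
weaken (me g∈ ne own k π)    D⊆E = me (D⊆E g∈) ne own k (weaken π (∷⁺ʳ _ D⊆E))

raise : ∀ {m n D} → m ≤ n → GameProof m D → GameProof n D
raise _         (axiom v)            = axiom v
raise (s≤s m≤n) (you g∈ ne own f)    = you g∈ ne own λ k → raise m≤n (f k)
raise (s≤s m≤n) (me g∈ ne own k π)   = me g∈ ne own k (raise m≤n π)

contract-⊆ : ∀ {x : GS} {E} → x ∷ x ∷ E ⊆ x ∷ E
contract-⊆ (here e)  = here e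
contract-⊆ (there p) = p

swap-⊆ : ∀ {x y : GS} {E} → x ∷ y ∷ E ⊆ y ∷ x ∷ E
swap-⊆ = ⊆-reflexive-↭ (swap _ _ ↭-refl)

infix 4 _⊆_except_
_⊆_except_ : DState → DState → GS → Set
D ⊆ E except g = ∀ {x} → x ∈ D → x ≢ g → x ∈ E

∷⁺-except : ∀ {D E g} y → D ⊆ E except g → (y ∷ D) ⊆ (y ∷ E) except g
∷⁺-except y D⊆E (here e)  _   = here e
∷⁺-except y D⊆E (there p) x≢g = there (D⊆E p x≢g)

⊆-except-─ : ∀ {g D E} (p : g ∈ E) → D ⊆ E → D ⊆ (E ─ p) except g
⊆-except-─ p D⊆E x∈ = ∈-─⁺ p (D⊆E x∈)

elementary≢ : ∀ {x g} → isElemGS x ≡ true → isElemGS g ≡ false → x ≢ g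
elementary≢ ex eg refl with () ← trans (sym ex) eg

invert : ∀ {n D E g} → GameProof n D → isElemGS g ≡ false → owner g ≡ You → (k : Idx g) →
         D ⊆ E except g → GameProof n (child g k ∷ E)
invert (axiom v) ne own k D⊆E = axiom λ M → let x , x∈ , ex , w = find (v M) in
  there (lose (D⊆E x∈ (elementary≢ ex ne)) (ex , w))
invert {g = g} (you {g = h} h∈ h-ne h-own f) ne own k D⊆E with h ≟GS g
... | yes refl = raise (ℕ.n≤1+n _) (weaken (invert (f k) ne own k (∷⁺-except _ D⊆E)) contract-⊆)
... | no h≢g   = you (there (D⊆E h∈ h≢g)) h-ne h-own λ k' →
                   weaken (invert (f k') ne own k (∷⁺-except _ D⊆E)) swap-⊆
invert {g = g} (me {g = h} h∈ h-ne h-own k' π) ne own k D⊆E with h ≟GS g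
... | yes refl with () ← trans (sym h-own) own
... | no h≢g   = me (there (D⊆E h∈ h≢g)) h-ne h-own k'
                   (weaken (invert π ne own k (∷⁺-except _ D⊆E)) swap-⊆)

rename : (Nom → Nom) → Fm → Fm
rename σ (var p)   = var p
rename σ (nom i)   = nom (σ i)
rename σ (rel i j) = rel (σ i) (σ j)
rename σ (a ∧ b)   = rename σ a ∧ rename σ b
rename σ (a ∨ b)   = rename σ a ∨ rename σ b
rename σ (a ⇒ b)   = rename σ a ⇒ rename σ b
rename σ (~ a)     = ~ rename σ a
rename σ (at i a)  = at (σ i) (rename σ a)
rename σ (□ a)     = □ rename σ a
rename σ (◇ a)     = ◇ rename σ a

renameGS : (Nom → Nom) → GS → GS
renameGS σ (lab q i a) = lab q (σ i) (rename σ a)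
renameGS σ (unl q a)   = unl q (rename σ a)

isElemGS-renameGS : ∀ σ g → isElemGS (renameGS σ g) ≡ isElemGS g
isElemGS-renameGS σ (lab q i (var _))   = refl
isElemGS-renameGS σ (lab q i (nom _))   = refl
isElemGS-renameGS σ (lab q i (rel _ _)) = refl
isElemGS-renameGS σ (lab q i (_ ∧ _))   = refl
isElemGS-renameGS σ (lab q i (_ ∨ _))   = refl
isElemGS-renameGS σ (lab q i (_ ⇒ _))   = refl
isElemGS-renameGS σ (lab q i (~ _))     = refl
isElemGS-renameGS σ (lab q i (at _ _))  = refl
isElemGS-renameGS σ (lab q i (□ _))     = refl
isElemGS-renameGS σ (lab q i (◇ _))     = refl
isElemGS-renameGS σ (unl q a)           = refl

owner-renameGS : ∀ σ g → owner (renameGS σ g) ≡ owner g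
owner-renameGS σ (lab q i (var _))   = refl
owner-renameGS σ (lab q i (nom _))   = refl
owner-renameGS σ (lab q i (rel _ _)) = refl
owner-renameGS σ (lab q i (_ ∧ _))   = refl
owner-renameGS σ (lab q i (_ ∨ _))   = refl
owner-renameGS σ (lab q i (_ ⇒ _))   = refl
owner-renameGS σ (lab q i (~ _))     = refl
owner-renameGS σ (lab q i (at _ _))  = refl
owner-renameGS σ (lab q i (□ _))     = refl
owner-renameGS σ (lab q i (◇ _))     = refl
owner-renameGS σ (unl q a)           = refl

renameGS-child : ∀ σ g (k : Idx g) → ∃ λ k' → renameGS σ (child g k) ≡ child (renameGS σ g) k'
renameGS-child σ (lab q i (a ∧ b)) true  = true , refl
renameGS-child σ (lab q i (a ∧ b)) false = false , refl
renameGS-child σ (lab q i (a ∨ b)) true  = true , refl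
renameGS-child σ (lab q i (a ∨ b)) false = false , refl
renameGS-child σ (lab q i (a ⇒ b)) true  = true , refl
renameGS-child σ (lab q i (a ⇒ b)) false = false , refl
renameGS-child σ (lab q i (~ a))   k     = tt , refl
renameGS-child σ (lab q i (at j a)) k    = tt , refl
renameGS-child σ (lab q i (□ a))   j     = σ j , refl
renameGS-child σ (lab q i (◇ a))   j     = σ j , refl
renameGS-child σ (unl q a)         i     = σ i , refl

renameGS-child⁻ : ∀ {σ} → StrictlySurjective _≡_ σ → ∀ g (k' : Idx (renameGS σ g)) →
                  ∃ λ k → renameGS σ (child g k) ≡ child (renameGS σ g) k'
renameGS-child⁻ σ-onto (lab q i (a ∧ b)) true     = true , refl
renameGS-child⁻ σ-onto (lab q i (a ∧ b)) false    = false , refl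
renameGS-child⁻ σ-onto (lab q i (a ∨ b)) true     = true , refl
renameGS-child⁻ σ-onto (lab q i (a ∨ b)) false    = false , refl
renameGS-child⁻ σ-onto (lab q i (a ⇒ b)) true     = true , refl
renameGS-child⁻ σ-onto (lab q i (a ⇒ b)) false    = false , refl
renameGS-child⁻ σ-onto (lab q i (~ a))   k'     = tt , refl
renameGS-child⁻ σ-onto (lab q i (at j a)) k'    = tt , refl
renameGS-child⁻ {σ} σ-onto (lab q i (□ a)) k'   = let j , σj≡k' = σ-onto k' in
  j , cong (λ m → lab q m (~ rel (σ i) m ∨ rename σ a)) σj≡k'
renameGS-child⁻ {σ} σ-onto (lab q i (◇ a)) k'   = let j , σj≡k' = σ-onto k' in
  j , cong (λ m → lab q m (rel (σ i) m ∧ rename σ a)) σj≡k'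
renameGS-child⁻ {σ} σ-onto (unl q a) k'         = let j , σj≡k' = σ-onto k' in
  j , cong (λ m → lab q m (rename σ a)) σj≡k'

precompose : (M : Model) (σ : Nom → Nom) → StrictlySurjective _≡_ σ → Model
precompose M σ σ-onto = record
  { W = Model.W M ; R = Model.R M ; V = Model.V M ; g = λ i → Model.g M (σ i)
  ; named = λ w → let i , gi≡w = Model.named M w ; j , σj≡i = σ-onto i in
                  j , trans (cong (Model.g M) σj≡i) gi≡w
  }

module _ (M : Model) {σ : Nom → Nom} (σ-onto : StrictlySurjective _≡_ σ) where

  private
    M∘σ = precompose M σ σ-onto

  holdsElem-precompose : ∀ i φ → holdsElem M∘σ i φ ≡ holdsElem M (σ i) (rename σ φ)
  holdsElem-precompose i (var _)   = refl
  holdsElem-precompose i (nom _)   = refl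
  holdsElem-precompose i (rel _ _) = refl
  holdsElem-precompose i (_ ∧ _)   = refl
  holdsElem-precompose i (_ ∨ _)   = refl
  holdsElem-precompose i (_ ⇒ _)   = refl
  holdsElem-precompose i (~ _)     = refl
  holdsElem-precompose i (at _ _)  = refl
  holdsElem-precompose i (□ _)     = refl
  holdsElem-precompose i (◇ _)     = refl

  leafI-precompose : ∀ x → leafI M∘σ x ≡ leafI M (renameGS σ x)
  leafI-precompose (lab P i φ) = holdsElem-precompose i φ
  leafI-precompose (lab O i φ) = cong ¬_ (holdsElem-precompose i φ)
  leafI-precompose (unl q a)   = refl

  Win-precompose : ∀ {x} → Win M∘σ x → Win M (renameGS σ x)
  Win-precompose {x} (leafW el l) =
    leafW (trans (isElemGS-renameGS σ x) el) (subst id (leafI-precompose x) l)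
  Win-precompose {x} (meW ne own k w) = let k' , e = renameGS-child σ x k in
    meW (trans (isElemGS-renameGS σ x) ne) (trans (owner-renameGS σ x) own) k'
        (subst (Win M) e (Win-precompose w))
  Win-precompose {x} (youW ne own f) =
    youW (trans (isElemGS-renameGS σ x) ne) (trans (owner-renameGS σ x) own) λ k' →
      let k , e = renameGS-child⁻ σ-onto x k' in subst (Win M) e (Win-precompose (f k))

RenamesInto : (Nom → Nom) → DState → DState → Set
RenamesInto σ D D' = ∀ {x} → x ∈ D → renameGS σ x ∈ D'

∷⁺-renames : ∀ {σ D D' y y'} → renameGS σ y ≡ y' → RenamesInto σ D D' → RenamesInto σ (y ∷ D) (y' ∷ D')
∷⁺-renames e c (here refl) = here e
∷⁺-renames e c (there p)   = there (c p)

rename-proof : ∀ {n D D' σ} → GameProof n D → StrictlySurjective _≡_ σ → RenamesInto σ D D' → GameProof n D'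
rename-proof {σ = σ} (axiom v) σ-onto c = axiom λ M →
  let x , x∈ , el , w = find (v (precompose M σ σ-onto)) in
  lose (c x∈) (trans (isElemGS-renameGS σ x) el , Win-precompose M σ-onto w)
rename-proof {σ = σ} (you {g = g} g∈ ne own f) σ-onto c =
  you (c g∈) (trans (isElemGS-renameGS σ g) ne) (trans (owner-renameGS σ g) own) λ k' →
    let k , e = renameGS-child⁻ σ-onto g k' in rename-proof (f k) σ-onto (∷⁺-renames e c)
rename-proof {σ = σ} (me {g = g} g∈ ne own k π) σ-onto c = let k' , e = renameGS-child σ g k in
  me (c g∈) (trans (isElemGS-renameGS σ g) ne) (trans (owner-renameGS σ g) own) k'
     (rename-proof π σ-onto (∷⁺-renames e c))

bound : Fm → ℕ
bound (var _)   = 0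
bound (nom i)   = suc i
bound (rel i j) = suc i ⊔ suc j
bound (a ∧ b)   = bound a ⊔ bound b
bound (a ∨ b)   = bound a ⊔ bound b
bound (a ⇒ b)   = bound a ⊔ bound b
bound (~ a)     = bound a
bound (at i a)  = suc i ⊔ bound a
bound (□ a)     = bound a
bound (◇ a)     = bound a

boundItem : Item → ℕ
boundItem (lb i φ) = suc i ⊔ bound φ
boundItem (pl φ)   = bound φ

boundItems : List Item → ℕ
boundItems []       = 0
boundItems (y ∷ ys) = boundItem y ⊔ boundItems ys

boundItems-All : ∀ {N} L → boundItems L ≤ N → All (λ y → boundItem y ≤ N) L
boundItems-All []       _ = []
boundItems-All (y ∷ ys) h = ℕ.m⊔n≤o⇒m≤o _ _ h ∷ boundItems-All ys (ℕ.m⊔n≤o⇒n≤o _ _ h)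

FixesBelow : (Nom → Nom) → Nom → ℕ → Set
FixesBelow σ j N = ∀ {i} → j ≢ i → i < N → σ i ≡ i

module _ {σ j N} (fix : FixesBelow σ j N) where

  rename-fresh : ∀ φ → freshFm j φ → bound φ ≤ N → rename σ φ ≡ φ
  rename-fresh (var p)   _         _ = refl
  rename-fresh (nom i)   j≢i       h = cong nom (fix j≢i h)
  rename-fresh (rel i k) (j≢i , j≢k) h =
    cong₂ rel (fix j≢i (ℕ.m⊔n≤o⇒m≤o (suc i) (suc k) h)) (fix j≢k (ℕ.m⊔n≤o⇒n≤o (suc i) (suc k) h))
  rename-fresh (a ∧ b) (fa , fb) h =
    cong₂ _∧_ (rename-fresh a fa (ℕ.m⊔n≤o⇒m≤o _ _ h)) (rename-fresh b fb (ℕ.m⊔n≤o⇒n≤o _ _ h))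
  rename-fresh (a ∨ b) (fa , fb) h =
    cong₂ _∨_ (rename-fresh a fa (ℕ.m⊔n≤o⇒m≤o _ _ h)) (rename-fresh b fb (ℕ.m⊔n≤o⇒n≤o _ _ h))
  rename-fresh (a ⇒ b) (fa , fb) h =
    cong₂ _⇒_ (rename-fresh a fa (ℕ.m⊔n≤o⇒m≤o _ _ h)) (rename-fresh b fb (ℕ.m⊔n≤o⇒n≤o _ _ h))
  rename-fresh (~ a)     fa        h = cong ~_ (rename-fresh a fa h)
  rename-fresh (at i a) (j≢i , fa) h =
    cong₂ at (fix j≢i (ℕ.m⊔n≤o⇒m≤o (suc i) (bound a) h)) (rename-fresh a fa (ℕ.m⊔n≤o⇒n≤o (suc i) _ h))
  rename-fresh (□ a)     fa        h = cong □_ (rename-fresh a fa h)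
  rename-fresh (◇ a)     fa        h = cong ◇_ (rename-fresh a fa h)

  renameGS-fresh : ∀ q y → freshItem j y → boundItem y ≤ N → renameGS σ (toGS q y) ≡ toGS q y
  renameGS-fresh q (lb i φ) (j≢i , fφ) h =
    cong₂ (lab q) (fix j≢i (ℕ.m⊔n≤o⇒m≤o (suc i) (bound φ) h)) (rename-fresh φ fφ (ℕ.m⊔n≤o⇒n≤o (suc i) _ h))
  renameGS-fresh q (pl φ) fφ h = cong (unl q) (rename-fresh φ fφ h)

  renameGS-freshMap : ∀ q L → All (freshItem j) L → boundItems L ≤ N →
                      ∀ {x} → x ∈ map (toGS q) L → renameGS σ x ≡ x
  renameGS-freshMap q L fL h x∈ with ∈-map⁻ (toGS q) x∈
  ... | y , y∈ , refl = renameGS-fresh q y (All.lookup fL y∈) (All.lookup (boundItems-All L h) y∈)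

  renameGS-freshSeq : ∀ Γ Δ → freshSeq j Γ Δ → boundItems Γ ⊔ boundItems Δ ≤ N →
                      ∀ {x} → x ∈ seqState Γ Δ → renameGS σ x ≡ x
  renameGS-freshSeq Γ Δ (fΓ , fΔ) h x∈ with ∈-++⁻ (map (toGS O) Γ) x∈
  ... | inj₁ x∈Γ = renameGS-freshMap O Γ fΓ (ℕ.m⊔n≤o⇒m≤o _ _ h) x∈Γ
  ... | inj₂ x∈Δ = renameGS-freshMap P Δ fΔ (ℕ.m⊔n≤o⇒n≤o _ _ h) x∈Δ

-- j ↦ k, the identity on the other nominals below N, and N + m ↦ m, so that it is onto.
instantiate : ℕ → Nom → Nom → Nom → Nom
instantiate N j k i with j ℕ.≟ i | i <? N
... | yes _ | _     = k
... | no _  | yes _ = i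
... | no _  | no _  = i ∸ N

instantiate-eigen : ∀ N j k → instantiate N j k j ≡ k
instantiate-eigen N j k with j ℕ.≟ j
... | yes _  = refl
... | no j≢j = ⊥-elim (j≢j refl)

instantiate-fixes : ∀ N j k → FixesBelow (instantiate N j k) j N
instantiate-fixes N j k {i} j≢i i<N with j ℕ.≟ i | i <? N
... | yes j≡i | _     = ⊥-elim (j≢i j≡i)
... | no _    | yes _ = refl
... | no _    | no i≮N = ⊥-elim (i≮N i<N)

instantiate-onto : ∀ {N j} k → j < N → StrictlySurjective _≡_ (instantiate N j k)
instantiate-onto {N} {j} k j<N m = N + m , N+m↦m
  where
  N+m↦m : instantiate N j k (N + m) ≡ m
  N+m↦m with j ℕ.≟ N + m | N + m <? N
  ... | yes j≡N+m | _         = ⊥-elim (ℕ.<-irrefl j≡N+m (ℕ.<-≤-trans j<N (ℕ.m≤m+n N m)))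
  ... | no _      | yes N+m<N = ⊥-elim (ℕ.<-irrefl refl (ℕ.<-≤-trans N+m<N (ℕ.m≤m+n N m)))
  ... | no _      | no _      = ℕ.m+n∸m≡n N m

module Eigen (Γ Δ : List Item) {j : Nom} (fresh : freshSeq j Γ Δ) (k : Nom) where

  σ : Nom → Nom
  σ = instantiate (suc j ⊔ (boundItems Γ ⊔ boundItems Δ)) j k

  σ-onto : StrictlySurjective _≡_ σ
  σ-onto = instantiate-onto k (ℕ.m≤m⊔n (suc j) (boundItems Γ ⊔ boundItems Δ))

  σ-eigen : σ j ≡ k
  σ-eigen = instantiate-eigen _ j k

  σ-fixes : ∀ {x} → x ∈ seqState Γ Δ → renameGS σ x ≡ x
  σ-fixes = renameGS-freshSeq (instantiate-fixes _ j k) Γ Δ fresh (ℕ.m≤n⊔m (suc j) _)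

  σ-keeps : ∀ {x} → x ∈ seqState Γ Δ → renameGS σ x ∈ seqState Γ Δ
  σ-keeps x∈ = subst (_∈ _) (sym (σ-fixes x∈)) x∈

  σ-premise : ∀ {c₀ c D} → renameGS σ c₀ ≡ c → D ⊆ c₀ ∷ seqState Γ Δ → RenamesInto σ D (c ∷ seqState Γ Δ)
  σ-premise e D⊆ x∈ with D⊆ x∈
  ... | here refl = here e
  ... | there p   = there (σ-keeps p)

module _ {σ : Nom → Nom} {q : Pol} {j k : Nom} {a : Fm} (σj≡k : σ j ≡ k) where

  instance-unl : renameGS σ (unl q a) ≡ unl q a → renameGS σ (lab q j a) ≡ lab q k a
  instance-unl fixed with rename σ a | fixed
  ... | _ | refl = cong (λ m → lab q m a) σj≡k

  instance-□ : ∀ {i} → renameGS σ (lab q i (□ a)) ≡ lab q i (□ a) →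
               renameGS σ (lab q j (~ rel i j ∨ a)) ≡ lab q k (~ rel i k ∨ a)
  instance-□ {i} fixed with σ i | rename σ a | fixed
  ... | _ | _ | refl = cong (λ m → lab q m (~ rel i m ∨ a)) σj≡k

  instance-◇ : ∀ {i} → renameGS σ (lab q i (◇ a)) ≡ lab q i (◇ a) →
               renameGS σ (lab q j (rel i j ∧ a)) ≡ lab q k (rel i k ∧ a)
  instance-◇ {i} fixed with σ i | rename σ a | fixed
  ... | _ | _ | refl = cong (λ m → lab q m (rel i m ∧ a)) σj≡k

fresh-above : ∀ {j} φ → bound φ ≤ j → freshFm j φ
fresh-above (var _)   _ = tt
fresh-above (nom i)   h = ℕ.>⇒≢ h
fresh-above (rel i k) h = ℕ.>⇒≢ (ℕ.m⊔n≤o⇒m≤o (suc i) (suc k) h) , ℕ.>⇒≢ (ℕ.m⊔n≤o⇒n≤o (suc i) (suc k) h)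
fresh-above (a ∧ b)   h = fresh-above a (ℕ.m⊔n≤o⇒m≤o _ _ h) , fresh-above b (ℕ.m⊔n≤o⇒n≤o (bound a) _ h)
fresh-above (a ∨ b)   h = fresh-above a (ℕ.m⊔n≤o⇒m≤o _ _ h) , fresh-above b (ℕ.m⊔n≤o⇒n≤o (bound a) _ h)
fresh-above (a ⇒ b)   h = fresh-above a (ℕ.m⊔n≤o⇒m≤o _ _ h) , fresh-above b (ℕ.m⊔n≤o⇒n≤o (bound a) _ h)
fresh-above (~ a)     h = fresh-above a h
fresh-above (at i a)  h = ℕ.>⇒≢ (ℕ.m⊔n≤o⇒m≤o (suc i) (bound a) h) , fresh-above a (ℕ.m⊔n≤o⇒n≤o (suc i) _ h)
fresh-above (□ a)     h = fresh-above a h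
fresh-above (◇ a)     h = fresh-above a h

freshItem-above : ∀ {j} y → boundItem y ≤ j → freshItem j y
freshItem-above (lb i φ) h = ℕ.>⇒≢ (ℕ.m⊔n≤o⇒m≤o (suc i) (bound φ) h) , fresh-above φ (ℕ.m⊔n≤o⇒n≤o (suc i) _ h)
freshItem-above (pl φ)   h = fresh-above φ h

freshSeq-above : ∀ Γ Δ → freshSeq (boundItems Γ ⊔ boundItems Δ) Γ Δ
freshSeq-above Γ Δ = fresh Γ (ℕ.m≤m⊔n _ _) , fresh Δ (ℕ.m≤n⊔m (boundItems Γ) _)
  where
  fresh : ∀ {j} L → boundItems L ≤ j → All (freshItem j) L
  fresh L h = All.map (λ {y} → freshItem-above y) (boundItems-All L h)

seqState-shift : ∀ Γ Δ y → seqState Γ (y ∷ Δ) ↭ toGS P y ∷ seqState Γ Δ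
seqState-shift Γ Δ y = shift (toGS P y) (map (toGS O) Γ) (map (toGS P) Δ)

module _ (Γ : List Item) {Δ : List Item} {y : Item} where

  ∷ʳ-⊆ : seqState Γ (y ∷ Δ) ⊆ toGS P y ∷ seqState Γ Δ
  ∷ʳ-⊆ = ⊆-reflexive-↭ (seqState-shift Γ Δ y)

  ∷ʳ-⊇ : toGS P y ∷ seqState Γ Δ ⊆ seqState Γ (y ∷ Δ)
  ∷ʳ-⊇ = ⊆-reflexive-↭ (↭-sym (seqState-shift Γ Δ y))

  principalʳ : toGS P y ∈ seqState Γ (y ∷ Δ)
  principalʳ = ∷ʳ-⊇ (here refl)

  weakenʳ : seqState Γ Δ ⊆ seqState Γ (y ∷ Δ)
  weakenʳ = ∷ʳ-⊇ ∘ there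

  premiseʳ : ∀ {S} → seqState Γ Δ ⊆ S → seqState Γ (y ∷ Δ) ⊆ toGS P y ∷ S
  premiseʳ Γ⊆S = ∷⁺ʳ _ Γ⊆S ∘ ∷ʳ-⊆

GameProvable : DState → Set₁
GameProvable D = ∃ λ n → GameProof n D

by-me : ∀ {D E g} → g ∈ D → isElemGS g ≡ false → owner g ≡ Me → (k : Idx g) →
        E ⊆ child g k ∷ D → GameProvable E → GameProvable D
by-me g∈ ne own k E⊆ (n , π) = suc n , me g∈ ne own k (weaken π E⊆)

common-height : ∀ {D E} → GameProvable D → GameProvable E → ∃ λ n → GameProof n D × GameProof n E
common-height (m , π) (n , π') = m ⊔ n , raise (ℕ.m≤m⊔n m n) π , raise (ℕ.m≤n⊔m m n) π'

contractʳ : ∀ Γ {Δ y} → seqState Γ (y ∷ y ∷ Δ) ⊆ seqState Γ (y ∷ Δ)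
contractʳ Γ x∈ with ∷ʳ-⊆ Γ x∈
... | here refl = principalʳ Γ
... | there p   = p

toGameProof : ∀ {Γ Δ} → Γ ⊢ Δ → GameProvable (seqState Γ Δ)
toGameProof (V el valid) = 0 , axiom λ M →
  let x , x∈ , w = find (valid M) in lose x∈ (All.lookup el x∈ , w)
toGameProof (exL {Δ = Δ} Γ↭Γ' d) = let n , π = toGameProof d in
  n , weaken π (⊆-reflexive-↭ (++⁺ʳ (map (toGS P) Δ) (map⁺ (toGS O) Γ↭Γ')))
toGameProof (exR {Γ} Δ↭Δ' d) = let n , π = toGameProof d in
  n , weaken π (⊆-reflexive-↭ (++⁺ˡ (map (toGS O) Γ) (map⁺ (toGS P) Δ↭Δ')))
toGameProof (CL d) = let n , π = toGameProof d in n , weaken π contract-⊆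
toGameProof (CR {Γ} d) = let n , π = toGameProof d in n , weaken π (contractʳ Γ)
toGameProof (U {i} {φ} fφ d) = let n , π = toGameProof d in
  suc n , you (here refl) refl refl λ k → let open Eigen [] [ pl φ ] ([] , fφ ∷ []) k in
    rename-proof π σ-onto (σ-premise (instance-unl σ-eigen (σ-fixes (here refl))) (∷⁺ʳ _ (λ ())))
toGameProof (L∨ d₁ d₂) = let n , π₁ , π₂ = common-height (toGameProof d₁) (toGameProof d₂) in
  suc n , you (here refl) refl refl λ where
    true  → weaken π₁ (∷⁺ʳ _ (xs⊆x∷xs _ _))
    false → weaken π₂ (∷⁺ʳ _ (xs⊆x∷xs _ _))
toGameProof (R∨₁ {Γ} d) = by-me (principalʳ Γ) refl refl true  (premiseʳ Γ (weakenʳ Γ)) (toGameProof d)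
toGameProof (R∨₂ {Γ} d) = by-me (principalʳ Γ) refl refl false (premiseʳ Γ (weakenʳ Γ)) (toGameProof d)
toGameProof (L∧₁ d) = by-me (here refl) refl refl true  (∷⁺ʳ _ (xs⊆x∷xs _ _)) (toGameProof d)
toGameProof (L∧₂ d) = by-me (here refl) refl refl false (∷⁺ʳ _ (xs⊆x∷xs _ _)) (toGameProof d)
toGameProof (R∧ {Γ} d₁ d₂) = let n , π₁ , π₂ = common-height (toGameProof d₁) (toGameProof d₂) in
  suc n , you (principalʳ Γ) refl refl λ where
    true  → weaken π₁ (premiseʳ Γ (weakenʳ Γ))
    false → weaken π₂ (premiseʳ Γ (weakenʳ Γ))
toGameProof (R⇒₁ {Γ} d) = by-me (principalʳ Γ) refl refl true  (∷⁺ʳ _ (weakenʳ Γ)) (toGameProof d)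
toGameProof (R⇒₂ {Γ} d) = by-me (principalʳ Γ) refl refl false (premiseʳ Γ (weakenʳ Γ)) (toGameProof d)
toGameProof (L⇒ {Γ} d₁ d₂) = let n , π₁ , π₂ = common-height (toGameProof d₁) (toGameProof d₂) in
  suc n , you (here refl) refl refl λ where
    true  → weaken π₁ (premiseʳ Γ (xs⊆x∷xs _ _))
    false → weaken π₂ (∷⁺ʳ _ (xs⊆x∷xs _ _))
toGameProof (L¬ {Γ} d) = let n , π = toGameProof d in
  suc n , you (here refl) refl refl λ _ → weaken π (premiseʳ Γ (xs⊆x∷xs _ _))
toGameProof (R¬ {Γ} d) = by-me (principalʳ Γ) refl refl tt (∷⁺ʳ _ (weakenʳ Γ)) (toGameProof d)
toGameProof (L□ {j = j} d) = by-me (here refl) refl refl j (∷⁺ʳ _ (xs⊆x∷xs _ _)) (toGameProof d)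
toGameProof (R□ {Γ} {Δ} {i} {a = a} fresh d) = let n , π = toGameProof d in
  suc n , you (principalʳ Γ) refl refl λ k → let open Eigen Γ (lb i (□ a) ∷ Δ) fresh k in
    rename-proof π σ-onto (σ-premise (instance-□ σ-eigen (σ-fixes (principalʳ Γ))) (premiseʳ Γ (weakenʳ Γ)))
toGameProof (L◇ {Γ} {Δ} {i} {a = a} fresh d) = let n , π = toGameProof d in
  suc n , you (here refl) refl refl λ k → let open Eigen (lb i (◇ a) ∷ Γ) Δ fresh k in
    rename-proof π σ-onto (σ-premise (instance-◇ σ-eigen (σ-fixes (here refl))) (∷⁺ʳ _ (xs⊆x∷xs _ _)))
toGameProof (R◇ {Γ} {j = j} d) = by-me (principalʳ Γ) refl refl j (premiseʳ Γ (weakenʳ Γ)) (toGameProof d)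
toGameProof (L-at d) = let n , π = toGameProof d in
  suc n , you (here refl) refl refl λ _ → weaken π (∷⁺ʳ _ (xs⊆x∷xs _ _))
toGameProof (R-at {Γ} d) = by-me (principalʳ Γ) refl refl tt (premiseʳ Γ (weakenʳ Γ)) (toGameProof d)

Key : Set
Key = List ℕ

keyOrder : DecTotalOrder _ _ _
keyOrder = ≤-decTotalOrder ℕ.<-strictTotalOrder

open DecTotalOrder keyOrder using (totalOrder; antisym) renaming (_≤_ to _≤ᴷ_)
open Data.List.Extrema totalOrder using (argmin; argmin-sel; f[argmin]≤f[⊤]; f[argmin]≤f[xs])

least : (GS → Key) → DState → GS
least κ []       = unl P (var 0)  -- junk: `select` is only used on states with a non-elementary member
least κ (x ∷ xs) = argmin κ x xs

least-∈ : ∀ κ {x} L → x ∈ L → least κ L ∈ L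
least-∈ κ (y ∷ ys) _ with argmin-sel κ y ys
... | inj₁ e = here e
... | inj₂ p = there p

least-≤ : ∀ κ {x} L → x ∈ L → κ (least κ L) ≤ᴷ κ x
least-≤ κ (y ∷ ys) (here refl) = f[argmin]≤f[⊤] {f = κ} y ys
least-≤ κ (y ∷ ys) (there p)   = All.lookup (f[argmin]≤f[xs] {f = κ} y ys) p

least-unique : ∀ {κ κ'} → (∀ x → κ x ≡ κ' x) → (∀ {x y} → κ x ≡ κ y → x ≡ y) →
               ∀ {L L'} → L ⊆ L' → L' ⊆ L → least κ L ≡ least κ' L'
least-unique κ≗κ' inj {[]}    {[]}    _    _    = refl
least-unique κ≗κ' inj {[]}    {_ ∷ _} _    L'⊆L with () ← L'⊆L (here refl)
least-unique κ≗κ' inj {_ ∷ _} {[]}    L⊆L' _    with () ← L⊆L' (here refl)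
least-unique {κ} {κ'} κ≗κ' inj {L@(_ ∷ _)} {L'@(_ ∷ _)} L⊆L' L'⊆L =
  inj (Pointwise-≡⇒≡ (antisym ℓ≤ℓ' ℓ'≤ℓ))
  where
  ℓ ℓ' : GS
  ℓ  = least κ L
  ℓ' = least κ' L'
  ℓ≤ℓ' : κ ℓ ≤ᴷ κ ℓ'
  ℓ≤ℓ' = least-≤ κ L (L'⊆L (least-∈ κ' L' (here refl)))
  ℓ'≤ℓ : κ ℓ' ≤ᴷ κ ℓ
  ℓ'≤ℓ = subst₂ _≤ᴷ_ (sym (κ≗κ' ℓ')) (sym (κ≗κ' ℓ)) (least-≤ κ' L' (L⊆L' (least-∈ κ L (here refl))))

≤ᴷ-head : ∀ {x y xs ys} → (x ∷ xs) ≤ᴷ (y ∷ ys) → x ≤ y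
≤ᴷ-head (this x<y)    = ℕ.<⇒≤ x<y
≤ᴷ-head (next refl _) = ℕ.≤-refl

≤ᴷ-tail : ∀ {x xs ys} → (x ∷ xs) ≤ᴷ (x ∷ ys) → xs ≤ᴷ ys
≤ᴷ-tail (this x<x)     = ⊥-elim (ℕ.<-irrefl refl x<x)
≤ᴷ-tail (next _ xs≤ys) = xs≤ys

tier : Player → ℕ
tier You = 0
tier Me  = 1

-- You-states first, then least multiplicity; the code only breaks ties, canonically, so that the
-- selection is invariant under permutation.
key : DState → GS → Key
key D x = tier (owner x) ∷ mult x D ∷ encodeGS x

key-injective : ∀ D {x y} → key D x ≡ key D y → x ≡ y
key-injective D e = encodeGS-injective (proj₂ (∷-injective (proj₂ (∷-injective e))))

key-↭ : ∀ {D D'} → D ↭ D' → ∀ x → key D x ≡ key D' x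
key-↭ p x = cong (λ n → tier (owner x) ∷ n ∷ encodeGS x) (mult-↭ x p)

nonElementary? : (g : GS) → Dec (isElemGS g ≡ false)
nonElementary? g = isElemGS g Bool.≟ false

nonElementary : DState → DState
nonElementary = filter nonElementary?

∈-nonElementary : ∀ {x D} → x ∈ D → isElemGS x ≡ false → x ∈ nonElementary D
∈-nonElementary = ∈-filter⁺ nonElementary?

∈-nonElementary⁻ : ∀ {x} D → x ∈ nonElementary D → x ∈ D × isElemGS x ≡ false
∈-nonElementary⁻ D = ∈-filter⁻ nonElementary?

select : DState → GS
select D = least (key D) (nonElementary D)

select-∈-nonElementary : ∀ D → NonElemD D → select D ∈ nonElementary D
select-∈-nonElementary D ne with find ne
... | x , x∈ , x-ne = least-∈ (key D) (nonElementary D) (∈-nonElementary x∈ x-ne)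

select-∈ : ∀ D → NonElemD D → select D ∈ D
select-∈ D ne = proj₁ (∈-nonElementary⁻ D (select-∈-nonElementary D ne))

select-nonElementary : ∀ D → NonElemD D → isElemGS (select D) ≡ false
select-nonElementary D ne = proj₂ (∈-nonElementary⁻ D (select-∈-nonElementary D ne))

select-minimal : ∀ D {x} → x ∈ D → isElemGS x ≡ false → key D (select D) ≤ᴷ key D x
select-minimal D x∈ x-ne = least-≤ (key D) (nonElementary D) (∈-nonElementary x∈ x-ne)

select-↭ : ∀ {D D'} → D ↭ D' → select D ≡ select D'
select-↭ {D} p = least-unique (key-↭ p) (key-injective D) (transport p) (transport (↭-sym p))
  where
  transport : ∀ {D D'} → D ↭ D' → nonElementary D ⊆ nonElementary D'
  transport p x∈ with ∈-nonElementary⁻ _ x∈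
  ... | x∈D , x-ne = ∈-nonElementary (∈-resp-↭ p x∈D) x-ne

fair : Regulation
fair = record
  { pick    = select
  ; pick-∈  = select-∈
  ; pick-ne = select-nonElementary
  ; pick-↭  = select-↭
  }

OnlyMeMoves : DState → Set
OnlyMeMoves E = ∀ {x} → x ∈ E → isElemGS x ≡ false → owner x ≡ Me

select-Me⇒OnlyMeMoves : ∀ D → owner (select D) ≡ Me → OnlyMeMoves D
select-Me⇒OnlyMeMoves D own {x} x∈ x-ne with owner x in e
... | Me  = refl
... | You with () ← subst₂ (λ o o' → tier o ≤ tier o') own e (≤ᴷ-head (select-minimal D x∈ x-ne))

select-mult-minimal : ∀ D {x} → x ∈ D → isElemGS x ≡ false → owner x ≡ owner (select D) →
                      mult (select D) D ≤ mult x D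
select-mult-minimal D {x} x∈ x-ne same =
  ≤ᴷ-head (≤ᴷ-tail (subst (λ o → key D (select D) ≤ᴷ (tier o ∷ mult x D ∷ encodeGS x)) same
                          (select-minimal D x∈ x-ne)))

weight : Fm → ℕ
weight (a ∧ b)  = suc (weight a + weight b)
weight (a ∨ b)  = suc (weight a + weight b)
weight (a ⇒ b)  = suc (weight a + weight b)
weight (~ a)    = suc (weight a)
weight (at i a) = suc (weight a)
weight (□ a)    = 3 + weight a
weight (◇ a)    = 2 + weight a
weight _        = 0

weightGS : GS → ℕ
weightGS (lab q i a) = weight a
weightGS (unl q a)   = suc (weight a)

weight-child : ∀ g → isElemGS g ≡ false → (k : Idx g) → weightGS (child g k) < weightGS g
weight-child (lab q i (a ∧ b)) _ true  = s≤s (ℕ.m≤m+n (weight a) (weight b))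
weight-child (lab q i (a ∧ b)) _ false = s≤s (ℕ.m≤n+m (weight b) (weight a))
weight-child (lab q i (a ∨ b)) _ true  = s≤s (ℕ.m≤m+n (weight a) (weight b))
weight-child (lab q i (a ∨ b)) _ false = s≤s (ℕ.m≤n+m (weight b) (weight a))
weight-child (lab q i (a ⇒ b)) _ true  = s≤s (ℕ.m≤m+n (weight a) (weight b))
weight-child (lab q i (a ⇒ b)) _ false = s≤s (ℕ.m≤n+m (weight b) (weight a))
weight-child (lab q i (~ a))   _ _     = ℕ.≤-refl
weight-child (lab q i (at j a)) _ _    = ℕ.≤-refl
weight-child (lab q i (□ a))   _ _     = ℕ.≤-refl
weight-child (lab q i (◇ a))   _ _     = ℕ.≤-refl
weight-child (unl q a)         _ _     = ℕ.≤-refl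

totalWeight : DState → ℕ
totalWeight D = sum (map weightGS D)

totalWeight-child : ∀ {g E} (p : g ∈ E) → isElemGS g ≡ false → (k : Idx g) →
                    totalWeight (child g k ∷ (E ─ p)) < totalWeight E
totalWeight-child {g} {E} p ne k = begin-strict
  weightGS (child g k) + totalWeight (E ─ p) <⟨ ℕ.+-monoˡ-< _ (weight-child g ne k) ⟩
  weightGS g + totalWeight (E ─ p)           ≡⟨ sum-↭ (map⁺ weightGS (─-↭ p)) ⟨
  totalWeight E                              ∎
  where open ℕ.≤-Reasoning

elementary? : (E : DState) → ElemD E ⊎ NonElemD E
elementary? [] = inj₁ []
elementary? (x ∷ E) with isElemGS x in e | elementary? E
... | false | _      = inj₂ (here e)
... | true  | inj₁ a = inj₁ (e ∷ a)
... | true  | inj₂ n = inj₂ (there n)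

some-child : ∀ g → isElemGS g ≡ false → Idx g
some-child (lab q i (a ∧ b))  _ = true
some-child (lab q i (a ∨ b))  _ = true
some-child (lab q i (a ⇒ b))  _ = true
some-child (lab q i (~ a))    _ = tt
some-child (lab q i (at j a)) _ = tt
some-child (lab q i (□ a))    _ = 0
some-child (lab q i (◇ a))    _ = 0
some-child (unl q a)          _ = 0

ElementarilyValid-child : ∀ {g E} (p : g ∈ E) → isElemGS g ≡ false → ∀ c →
                          ElementarilyValid E → ElementarilyValid (c ∷ (E ─ p))
ElementarilyValid-child p ne c v M = let x , x∈ , el , w = find (v M) in
  there (lose (∈-─⁺ p x∈ (elementary≢ el ne)) (el , w))

module _ (ρ : Regulation) where
  open Regulation ρ

  totalWeight-pick : ∀ {E w} (ne : NonElemD E) (k : Idx (pick E)) → totalWeight E ≤ suc w →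
                     totalWeight (child (pick E) k ∷ (E ─ pick-∈ E ne)) ≤ w
  totalWeight-pick ne k ≤w = ℕ.≤-pred (ℕ.<-≤-trans (totalWeight-child (pick-∈ _ ne) (pick-ne _ ne) k) ≤w)

  totalWeight-positive : ∀ {E} → NonElemD E → totalWeight E ≢ 0
  totalWeight-positive {E} ne ≡0 =
    ℕ.n≮0 (ℕ.<-≤-trans (totalWeight-child (pick-∈ E ne) (pick-ne E ne) (some-child _ (pick-ne E ne)))
                       (ℕ.≤-reflexive ≡0))

  validStrategy : ∀ w {E} → ElementarilyValid E → totalWeight E ≤ w → DWin ρ E
  validStrategy w {E} v ≤w with elementary? E
  ... | inj₁ el = dleaf el λ M → Any.map proj₂ (v M)
  ... | inj₂ ne with owner (pick E) in own | w
  ...   | _   | zero  = ⊥-elim (totalWeight-positive ne (ℕ.n≤0⇒n≡0 ≤w))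
  ...   | You | suc w = dyou ne own λ k →
          validStrategy w (ElementarilyValid-child _ (pick-ne E ne) _ v) (totalWeight-pick ne k ≤w)
  ...   | Me  | suc w = dme ne own k
          (validStrategy w (ElementarilyValid-child _ (pick-ne E ne) _ v) (totalWeight-pick ne k ≤w))
    where k = some-child (pick E) (pick-ne E ne)

sum-map-≤ : ∀ {A : Set} {f g : A → ℕ} → (∀ x → f x ≤ g x) → ∀ L → sum (map f L) ≤ sum (map g L)
sum-map-≤ f≤g []      = z≤n
sum-map-≤ f≤g (x ∷ L) = ℕ.+-mono-≤ (f≤g x) (sum-map-≤ f≤g L)

sum-map-< : ∀ {A : Set} {f g : A → ℕ} → (∀ x → f x ≤ g x) → ∀ {x L} → x ∈ L → f x < g x →
            sum (map f L) < sum (map g L)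
sum-map-< f≤g {L = _ ∷ L} (here refl) fx<gx = ℕ.+-mono-<-≤ fx<gx (sum-map-≤ f≤g L)
sum-map-< f≤g {L = y ∷ _} (there x∈)  fx<gx = ℕ.+-mono-≤-< (f≤g y) (sum-map-< f≤g x∈ fx<gx)

GameProof⇒ElementarilyValid : ∀ {n D E} → GameProof n D → D ⊆ E → ElemD E → ElementarilyValid E
GameProof⇒ElementarilyValid (axiom v)          D⊆E _  M = Any-resp-⊆ D⊆E (v M)
GameProof⇒ElementarilyValid (you g∈ ne _ _)    D⊆E el with () ← trans (sym (All.lookup el (D⊆E g∈))) ne
GameProof⇒ElementarilyValid (me g∈ ne _ _ _)   D⊆E el with () ← trans (sym (All.lookup el (D⊆E g∈))) ne

WinsByMovingDoubled : GS → DState → Set₁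
WinsByMovingDoubled h E₀ =
  ∀ {E} → E₀ ⊆ E → (p : h ∈ E) → 2 ≤ mult h E → Σ (Idx h) λ k → DWin fair (child h k ∷ (E ─ p))

-- To play h, whatever `fair` selects is duplicated until it selects h with multiplicity ≥ 2.
-- Selected states have least multiplicity, so all multiplicities stay below B and Φ decreases.
module DuplicationPhase
  (E₀ : DState) (me-only : OnlyMeMoves E₀) {h : GS} (h∈E₀ : h ∈ E₀) (h-ne : isElemGS h ≡ false)
  (resume : WinsByMovingDoubled h E₀)
  where

  B : ℕ
  B = 2 + mult h E₀

  Φ : DState → ℕ
  Φ E = sum (map (λ s → B ∸ mult s E) E₀)

  Φ-dup : ∀ {g E} → g ∈ E₀ → mult g E < B → Φ (g ∷ E) < Φ E
  Φ-dup {g} {E} g∈ g<B = sum-map-< (λ s → ℕ.∸-monoʳ-≤ B (mult-∷ s g E)) g∈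
    (subst (λ m → B ∸ m < B ∸ mult g E) (sym (mult-here g E)) (ℕ.∸-monoʳ-< ℕ.≤-refl g<B))

  doubled<B : ∀ {E} → mult h E ≤ 1 → mult h (h ∷ E) < B
  doubled<B {E} h≤1 = subst (_< B) (sym (mult-here h E)) (s≤s (s≤s (ℕ.≤-trans h≤1 (∈⇒mult-pos h∈E₀))))

  phase : ∀ f {E} → Φ E < f → E₀ ⊆ E → E ⊆ E₀ → h ∈ E → mult h E < B → DWin fair E
  phase (suc f) {E} Φ<f E₀⊆E E⊆E₀ h∈E h<B = step (select E ≟GS h)
    where
    ne : NonElemD E
    ne = lose h∈E h-ne
    sel∈ : select E ∈ E
    sel∈ = select-∈ E ne
    own : owner (select E) ≡ Me
    own = me-only (E⊆E₀ sel∈) (select-nonElementary E ne)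
    sel≤h : mult (select E) E ≤ mult h E
    sel≤h = select-mult-minimal E h∈E h-ne (trans (me-only (E⊆E₀ h∈E) h-ne) (sym own))

    duplicate : mult h (select E ∷ E) < B → DWin fair E
    duplicate h<B' = ddup ne own (phase f Φ'<f (xs⊆x∷xs _ _ ∘ E₀⊆E) E'⊆E₀ (there h∈E) h<B')
      where
      Φ'<f : Φ (select E ∷ E) < f
      Φ'<f = ℕ.<-≤-trans (Φ-dup (E⊆E₀ sel∈) (ℕ.≤-<-trans sel≤h h<B)) (ℕ.≤-pred Φ<f)
      E'⊆E₀ : select E ∷ E ⊆ E₀
      E'⊆E₀ (here refl) = E⊆E₀ sel∈
      E'⊆E₀ (there x∈)  = E⊆E₀ x∈

    play : select E ≡ h → 2 ≤ mult h E → DWin fair E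
    play refl 2≤ = let k , w = resume E₀⊆E sel∈ 2≤ in dme ne own k w

    step : Dec (select E ≡ h) → DWin fair E
    step (no sel≢h) = duplicate (subst (_< B) (sym (mult-there E (sel≢h ∘ sym))) h<B)
    step (yes sel≡h) with 2 ≤? mult h E
    ... | yes 2≤ = play sel≡h 2≤
    ... | no 2≰   =
      duplicate (subst (λ g → mult h (g ∷ E) < B) (sym sel≡h) (doubled<B (ℕ.≤-pred (ℕ.≰⇒> 2≰))))

  strategy : DWin fair E₀
  strategy = phase (suc (Φ E₀)) ℕ.≤-refl ⊆-refl ⊆-refl h∈E₀ (ℕ.m<n+m _ (s≤s z≤n))

fairStrategy : ∀ n w {D E} → GameProof n D → D ⊆ E → totalWeight E ≤ w → DWin fair E
fairStrategy n w {D} {E} π D⊆E ≤w with elementary? E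
... | inj₁ el = dleaf el λ M → Any.map proj₂ (GameProof⇒ElementarilyValid π D⊆E el M)
... | inj₂ ne with owner (select E) in own | w
...   | _   | zero  = ⊥-elim (totalWeight-positive fair ne (ℕ.n≤0⇒n≡0 ≤w))
...   | You | suc w = dyou ne own λ k →
          fairStrategy n w (invert π (select-nonElementary E ne) own k (⊆-except-─ (select-∈ E ne) D⊆E))
                       ⊆-refl (totalWeight-pick fair ne k ≤w)
...   | Me  | _     = play-Me π (select-Me⇒OnlyMeMoves E own)
  where
  play-Me : GameProof n D → OnlyMeMoves E → DWin fair E
  play-Me (axiom v) _ = validStrategy fair _ (λ M → Any-resp-⊆ D⊆E (v M)) ℕ.≤-refl
  play-Me (you g∈ g-ne g-own _) me-only with () ← trans (sym (me-only (D⊆E g∈) g-ne)) g-own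
  play-Me (me {n = m} {g = h} h∈ h-ne _ k π') me-only =
    DuplicationPhase.strategy E me-only (D⊆E h∈) h-ne resume
    where
    resume : WinsByMovingDoubled h E
    resume E⊆E' p 2≤ = k , fairStrategy m _ π' (∷⁺ʳ _ (⊆-─ p (E⊆E' ∘ D⊆E) 2≤)) ℕ.≤-refl

asAntecedent asSuccedent : GS → Maybe Item
asAntecedent (lab O i φ) = just (lb i φ)
asAntecedent (unl O φ)   = just (pl φ)
asAntecedent _           = nothing
asSuccedent (lab P i φ)  = just (lb i φ)
asSuccedent (unl P φ)    = just (pl φ)
asSuccedent _            = nothing

Derivable : DState → Set₁
Derivable D = mapMaybe asAntecedent D ⊢ mapMaybe asSuccedent D

seqState-split : ∀ D → seqState (mapMaybe asAntecedent D) (mapMaybe asSuccedent D) ↭ D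
seqState-split []              = ↭-refl
seqState-split (lab O i φ ∷ D) = prep _ (seqState-split D)
seqState-split (unl O φ ∷ D)   = prep _ (seqState-split D)
seqState-split (lab P i φ ∷ D) = ↭-trans (seqState-shift _ _ (lb i φ)) (prep _ (seqState-split D))
seqState-split (unl P φ ∷ D)   = ↭-trans (seqState-shift _ _ (pl φ)) (prep _ (seqState-split D))

Derivable-↭ : ∀ {D D'} → D ↭ D' → Derivable D → Derivable D'
Derivable-↭ p d = exR (mapMaybe-↭ asSuccedent p) (exL (mapMaybe-↭ asAntecedent p) d)

-- Only the root state P:φ is unlabelled; its move is (U), handled in fromWinning.
Labelled : GS → Set
Labelled (lab _ _ _) = ⊤
Labelled (unl _ _)   = ⊥

Labelled-child : ∀ g → Labelled g → (k : Idx g) → Labelled (child g k)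
Labelled-child (lab q i (a ∧ b))  _ true  = tt
Labelled-child (lab q i (a ∧ b))  _ false = tt
Labelled-child (lab q i (a ∨ b))  _ true  = tt
Labelled-child (lab q i (a ∨ b))  _ false = tt
Labelled-child (lab q i (a ⇒ b))  _ true  = tt
Labelled-child (lab q i (a ⇒ b))  _ false = tt
Labelled-child (lab q i (~ a))    _ _     = tt
Labelled-child (lab q i (at j a)) _ _     = tt
Labelled-child (lab q i (□ a))    _ _     = tt
Labelled-child (lab q i (◇ a))    _ _     = tt

you-rule : ∀ g R → Labelled g → owner g ≡ You →
           ((k : Idx g) → Derivable (child g k ∷ R)) → Derivable (g ∷ R)
you-rule (lab P i (a ∧ b))    R _ _ d = R∧ (d true) (d false)
you-rule (lab O i (a ∨ b))    R _ _ d = L∨ (d true) (d false)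
you-rule (lab O i (a ⇒ b))    R _ _ d = L⇒ (d true) (d false)
you-rule (lab O i (~ a))      R _ _ d = L¬ (d tt)
you-rule (lab O i (at j a))   R _ _ d = L-at (d tt)
you-rule (lab P i (□ a))      R _ _ d =
  R□ (freshSeq-above (mapMaybe asAntecedent R) (lb i (□ a) ∷ mapMaybe asSuccedent R)) (d _)
you-rule (lab O i (◇ a))      R _ _ d =
  L◇ (freshSeq-above (lb i (◇ a) ∷ mapMaybe asAntecedent R) (mapMaybe asSuccedent R)) (d _)
you-rule (lab O i (_ ∧ _))    R _ () _
you-rule (lab P i (_ ∨ _))    R _ () _
you-rule (lab P i (_ ⇒ _))    R _ () _
you-rule (lab P i (~ _))      R _ () _
you-rule (lab P i (at _ _))   R _ () _
you-rule (lab O i (□ _))      R _ () _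
you-rule (lab P i (◇ _))      R _ () _
you-rule (lab q i (var _))    R _ () _
you-rule (lab q i (nom _))    R _ () _
you-rule (lab q i (rel _ _))  R _ () _

me-rule : ∀ g R → Labelled g → owner g ≡ Me →
          (k : Idx g) → Derivable (child g k ∷ R) → Derivable (g ∷ R)
me-rule (lab O i (a ∧ b))    R _ _ true  d = L∧₁ d
me-rule (lab O i (a ∧ b))    R _ _ false d = L∧₂ d
me-rule (lab P i (a ∨ b))    R _ _ true  d = R∨₁ d
me-rule (lab P i (a ∨ b))    R _ _ false d = R∨₂ d
me-rule (lab P i (a ⇒ b))    R _ _ true  d = R⇒₁ d
me-rule (lab P i (a ⇒ b))    R _ _ false d = R⇒₂ d
me-rule (lab P i (~ a))      R _ _ _     d = R¬ d
me-rule (lab P i (at j a))   R _ _ _     d = R-at d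
me-rule (lab O i (□ a))      R _ _ _     d = L□ d
me-rule (lab P i (◇ a))      R _ _ _     d = R◇ d
me-rule (lab P i (_ ∧ _))    R _ () _ _
me-rule (lab O i (_ ∨ _))    R _ () _ _
me-rule (lab O i (_ ⇒ _))    R _ () _ _
me-rule (lab O i (~ _))      R _ () _ _
me-rule (lab O i (at _ _))   R _ () _ _
me-rule (lab P i (□ _))      R _ () _ _
me-rule (lab O i (◇ _))      R _ () _ _

contract-rule : ∀ g R → Labelled g → Derivable (g ∷ g ∷ R) → Derivable (g ∷ R)
contract-rule (lab O i φ) R _ d = CL d
contract-rule (lab P i φ) R _ d = CR d

Derivable-─ : ∀ {g D} (p : g ∈ D) → Derivable (g ∷ (D ─ p)) → Derivable D
Derivable-─ p = Derivable-↭ (↭-sym (─-↭ p))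

fromStrategy : ∀ {ρ D} → DWin ρ D → All Labelled D → Derivable D
fromStrategy {D = D} (dleaf el valid) _ =
  V (All-resp-↭ (↭-sym (seqState-split D)) el) λ M → Any-resp-↭ (↭-sym (seqState-split D)) (valid M)
fromStrategy {ρ} {D} (dyou ne own f) labs =
  let p = Regulation.pick-∈ ρ D ne ; ℓ = All.lookup labs p in
  Derivable-─ p (you-rule _ (D ─ p) ℓ own λ k → fromStrategy (f k) (Labelled-child _ ℓ k ∷ ─⁺ p labs))
fromStrategy {ρ} {D} (dme ne own k w) labs =
  let p = Regulation.pick-∈ ρ D ne ; ℓ = All.lookup labs p in
  Derivable-─ p (me-rule _ (D ─ p) ℓ own k (fromStrategy w (Labelled-child _ ℓ k ∷ ─⁺ p labs)))
fromStrategy {ρ} {D} (ddup ne own w) labs =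
  let p = Regulation.pick-∈ ρ D ne ; ℓ = All.lookup labs p in
  Derivable-─ p (contract-rule _ (D ─ p) ℓ
    (Derivable-↭ (prep (Regulation.pick ρ D) (─-↭ p)) (fromStrategy w (ℓ ∷ labs))))

module _ {ρ : Regulation} {φ : Fm} where

  private
    instantiate-U : ∀ g (p : g ∈ [ unl P φ ]) → ((k : Idx g) → DWin ρ (child g k ∷ ([ unl P φ ] ─ p))) →
                    [] ⊢ [ pl φ ]
    instantiate-U _ (here refl) f = U (fresh-above φ ℕ.≤-refl) (fromStrategy (f (bound φ)) (tt ∷ []))

    owned-by-You : ∀ {g} → g ∈ [ unl P φ ] → owner g ≡ You
    owned-by-You (here refl) = refl

  fromWinning : DWin ρ [ unl P φ ] → [] ⊢ [ pl φ ]
  fromWinning (dleaf (() ∷ _) _)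
  fromWinning (dyou ne _ f)     = instantiate-U _ (Regulation.pick-∈ ρ _ ne) f
  fromWinning (dme ne own _ _)  with () ← trans (sym own) (owned-by-You (Regulation.pick-∈ ρ _ ne))
  fromWinning (ddup ne own _)   with () ← trans (sym own) (owned-by-You (Regulation.pick-∈ ρ _ ne))

proposition3 : ∀ (φ : Fm) → ([] ⊢ [ pl φ ]) ⇔ Winning [ unl P φ ]
proposition3 φ = mk⇔ sound complete
  where
  sound : [] ⊢ [ pl φ ] → Winning [ unl P φ ]
  sound d = let n , π = toGameProof d in fair , fairStrategy n _ π ⊆-refl ℕ.≤-refl
  complete : Winning [ unl P φ ] → [] ⊢ [ pl φ ]
  complete (ρ , w) = fromWinning w
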